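{- Let $\mathcal{W}=(S_\mathcal{W},s^0_\mathcal{W},\delta_\mathcal{W})$, the parameter subsets $P_1,\dots,P_n$, and the deterministic machines $\mathcal{W}_i=(S_i,s^0_i,\delta_i)$ with knowledge labels $K_i:S_i\to 2^{S_\mathcal{W}}$ be as in the context. Let $(s,A,s')\in\delta_\mathcal{W}$ be such that $A$ contains a method-call proposition whose parameter set is $P_i$. Then for every state $s_i\in S_i$ with $s\in K_i(s_i)$ and every transition $(s_i,A\cup\{\mathit{in}_s\},s_i')\in\delta_i$, we have $s'\in K_i(s_i')$. Furthermore, for every $j\neq i$ and every state $s_j\in S_j$, if $s\in K_j(s_j)$ then $s'\in K_j(s_j)$.
   Context: Let $P$ be a finite set of parameters and let $P_1,\dots,P_n$ ($n=2^{|P|}$) enumerate all subsets of $P$. Let $AP=I\cup O$ (disjoint inputs and outputs) be a finite set of atomic propositions, each of the form $a(Q)$ where $Q$ is a sequence of distinct parameters from $P$ (possibly empty); parameter sequences are identified with their sets. A subset $I_{\mathit{call}}\subseteq I$ of propositions are method-call propositions. A state machine over alphabet $\Sigma$ is a tuple $(S,s_0,\delta)$ with $\delta\subseteq S\times\Sigma\times S$. Let $\mathcal{W}=(S_\mathcal{W},s^0_\mathcal{W},\delta_\mathcal{W})$ be a finite-state machine over $2^{AP}$ in which every transition label contains exactly one method-call proposition. Splitting construction. Introduce a fresh guard proposition $\mathit{in}_s$ for each $s\in S_\mathcal{W}$. For each $i$, let $\mathcal{N}_i$ be the nondeterministic automaton with states $S_\mathcal{W}$, initial state $s^0_\mathcal{W}$,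 and, for every $(s,A,s')\in\delta_\mathcal{W}$: a transition $(s,A\cup\{\mathit{in}_s\},s')$ if $A$ contains a method-call proposition whose parameter set is exactly $P_i$, and an $\varepsilon$-transition from $s$ to $s'$ otherwise. $\mathcal{W}_i=(S_i,s^0_i,\delta_i)$ is obtained from $\mathcal{N}_i$ by the standard subset construction (removing $\varepsilon$-transitions via $\varepsilon$-closure): its states are sets of states of $S_\mathcal{W}$, the initial state is the $\varepsilon$-closure of $\{s^0_\mathcal{W}\}$, and from a state $X$ on a letter $L$ the successor is the $\varepsilon$-closure of $\{s'\mid \exists s\in X,\ (s,L,s')\text{ a transition of }\mathcal{N}_i\}$ whenever this set is nonempty. The knowledge label $K_i(X)\subseteq S_\mathcal{W}$ of a state $X\in S_i$ is the subset of $S_\mathcal{W}$ it represents. -}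

module Defs where

open import Data.Nat using (ℕ)
open import Data.Bool using (Bool; true; false)
open import Data.Fin using (Fin)
open import Data.Fin.Subset using (Subset; _∈_; ⁅_⁆)
open import Data.List using (List)
open import Data.List.Membership.Propositional renaming (_∈_ to _∈ˡ_)
open import Data.Product using (Σ; ∃; ∃-syntax; _×_; _,_)
open import Relation.Binary.PropositionalEquality using (_≡_)
open import Relation.Nullary using (¬_)
open import Function.Bundles using (_⇔_)

-- Parameters P = Fin p; the subsets P_1..P_n of P are enumerated by
-- Subset p itself (the index i of P_i is the subset P_i).
-- Atomic propositions AP = Fin m; each a(Q) has parameter set param a.  Letters of W: Subset m (subsets of AP).
record Machine (p m k : ℕ) : Set where
  field
    param     : Fin m → Subset p
    isInput   : Fin m → Bool         -- AP = I ∪ O, I = {a | isInput a}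
    isCall    : Fin m → Bool
    callInput : ∀ a → isCall a ≡ true → isInput a ≡ true
    s0        : Fin k
    δ         : List (Fin k × Subset m × Fin k)
    oneCall   : ∀ {s A s'} → (s , A , s') ∈ˡ δ →
                Σ (Fin m) λ a → a ∈ A × isCall a ≡ true ×
                  (∀ b → b ∈ A → isCall b ≡ true → b ≡ a)

open Machine public

module _ {p m k : ℕ} (W : Machine p m k) where

  HasCall : Subset p → Subset m → Set
  HasCall Pi A = Σ (Fin m) λ a → a ∈ A × isCall W a ≡ true × param W a ≡ Pi

  -- Letters of N_i: subsets of AP ∪ {in_s | s ∈ S_W}, encoded as a pair
  -- (AP-part, guard-part).  A ∪ {in_s} is (A , ⁅ s ⁆).
  Letter : Set
  Letter = Subset m × Subset k

  NTrans : Subset p → Fin k → Letter → Fin k → Set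
  NTrans Pi s L s' = Σ (Subset m) λ A →
    (s , A , s') ∈ˡ δ W × HasCall Pi A × L ≡ (A , ⁅ s ⁆)

  EpsTrans : Subset p → Fin k → Fin k → Set
  EpsTrans Pi s s' = Σ (Subset m) λ A → (s , A , s') ∈ˡ δ W × ¬ HasCall Pi A

  data EpsClos (Pi : Subset p) (X : Fin k → Set) : Fin k → Set where
    base : ∀ {s} → X s → EpsClos Pi X s
    step : ∀ {s s'} → EpsClos Pi X s → EpsTrans Pi s s' → EpsClos Pi X s'

  Post : Subset p → Subset k → Letter → Fin k → Set
  Post Pi X L s' = Σ (Fin k) λ s → s ∈ X × NTrans Pi s L s'

  IsClosure : Subset p → (Fin k → Set) → Subset k → Set
  IsClosure Pi Z Y = ∀ t → (t ∈ Y) ⇔ EpsClos Pi Z t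

  -- one step of the subset construction (defined only if Post nonempty)
  Succ : Subset p → Subset k → Letter → Subset k → Set
  Succ Pi X L Y = (∃[ t ] Post Pi X L t) × IsClosure Pi (Post Pi X L) Y

  -- S_i: the states of W_i, those reachable from the initial state
  data Reachable (Pi : Subset p) : Subset k → Set where
    init : ∀ {X} → IsClosure Pi (λ t → t ≡ s0 W) X → Reachable Pi X
    next : ∀ {X L Y} → Reachable Pi X → Succ Pi X L Y → Reachable Pi Y

  Delta : Subset p → Subset k → Letter → Subset k → Set
  Delta Pi X L Y = Reachable Pi X × Succ Pi X L Y

  K : Subset p → Subset k → Subset k
  K Pi X = X

{-# OPTIONS --safe #-}
module Submission where

open import Defs
open import Data.Nat using (ℕ)
open import Data.Bool using (true)
open import Data.Fin using (Fin)
open import Data.Fin.Subset using (Subset; _∈_; ⁅_⁆)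
open import Data.List.Membership.Propositional renaming (_∈_ to _∈ˡ_)
open import Data.Product using (_×_; _,_; proj₁; proj₂)
open import Relation.Binary.PropositionalEquality using (_≡_; _≢_; refl; sym; cong; module ≡-Reasoning)
open import Function.Bundles using (Equivalence)

-- The call transition (s, A, s') is a labelled transition of N_i and, since the
-- unique call in A has parameter set P_i, an ε-transition of every N_j with j ≠ i.
-- States of W_j are ε-closed, so they pass from s to s' without moving.

module _ {p m k : ℕ} (W : Machine p m k) where

  closure-closed-under-ε : ∀ {Pi Z Y} → IsClosure W Pi Z Y →
                           ∀ {t t'} → t ∈ Y → EpsTrans W Pi t t' → t' ∈ Y
  closure-closed-under-ε Y≈Z* {t} {t'} t∈Y t→t' =
    Equivalence.from (Y≈Z* t') (step (Equivalence.to (Y≈Z* t) t∈Y) t→t')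

  reachable-closed-under-ε : ∀ {Pi Y} → Reachable W Pi Y →
                             ∀ {t t'} → t ∈ Y → EpsTrans W Pi t t' → t' ∈ Y
  reachable-closed-under-ε (init Y≈Z*)         = closure-closed-under-ε Y≈Z*
  reachable-closed-under-ε (next _ (_ , Y≈Z*)) = closure-closed-under-ε Y≈Z*

  post⊆succ : ∀ {Pi X L Y t} → Succ W Pi X L Y → Post W Pi X L t → t ∈ Y
  post⊆succ {t = t} (_ , Y≈Z*) t∈Post = Equivalence.from (Y≈Z* t) (base t∈Post)

  hasCall-unique : ∀ {s A s' Pi Pj} → (s , A , s') ∈ˡ δ W →
                   HasCall W Pi A → HasCall W Pj A → Pj ≡ Pi
  hasCall-unique {A = A} {Pi = Pi} {Pj} tr (a , a∈A , call-a , param-a) (b , b∈A , call-b , param-b) =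
    begin
      Pj          ≡⟨ sym param-b ⟩
      param W b   ≡⟨ cong (param W) (only-call b b∈A call-b) ⟩
      param W c   ≡⟨ cong (param W) (sym (only-call a a∈A call-a)) ⟩
      param W a   ≡⟨ param-a ⟩
      Pi          ∎
    where
    open ≡-Reasoning
    c : Fin m
    c = proj₁ (oneCall W tr)
    only-call : ∀ x → x ∈ A → isCall W x ≡ true → x ≡ c
    only-call = proj₂ (proj₂ (proj₂ (oneCall W tr)))

proposition2 : ∀ {p m k : ℕ} (W : Machine p m k) (Pi : Subset p)
                 (s : Fin k) (A : Subset m) (s' : Fin k) →
                 (s , A , s') ∈ˡ δ W → HasCall W Pi A →
                 (∀ (Xi Xi' : Subset k) → Reachable W Pi Xi → s ∈ K W Pi Xi →
                    Delta W Pi Xi (A , ⁅ s ⁆) Xi' → s' ∈ K W Pi Xi')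
                 × (∀ (Pj : Subset p) → Pj ≢ Pi → ∀ (Xj : Subset k) →
                    Reachable W Pj Xj → s ∈ K W Pj Xj → s' ∈ K W Pj Xj)
proposition2 W Pi s A s' tr callᵢ = labelled-step , ε-step
  where
  labelled-step : ∀ Xi Xi' → Reachable W Pi Xi → s ∈ Xi →
                  Delta W Pi Xi (A , ⁅ s ⁆) Xi' → s' ∈ Xi'
  labelled-step _ _ _ s∈Xi (_ , succ) = post⊆succ W succ (s , s∈Xi , A , tr , callᵢ , refl)

  ε-step : ∀ Pj → Pj ≢ Pi → ∀ Xj → Reachable W Pj Xj → s ∈ Xj → s' ∈ Xj
  ε-step Pj j≢i _ reach s∈Xj =
    reachable-closed-under-ε W reach s∈Xj (A , tr , λ callⱼ → j≢i (hasCall-unique W tr callᵢ callⱼ))
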